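{- Let $n\ge 2$ be an integer. If $A=\begin{pmatrix}0&1\\1&d\end{pmatrix}$ for some $d\in\{0,1\}$, then all of $(K_{n+2}\oplus_{=} K_{n+2})^{n+2}_A$, $(K_{n+2}\oplus_{=} \overline{K_{n+2}})^{n+2}_A$, $(K_{n+2}\oplus_{\neq} K_{n+2})^{n+2}_A$, and $(K_{n+2}\oplus_{\neq} \overline{K_{n+2}})^{n+2}_A$ have vertex-minors isomorphic to $nT_{2,n}$.
   Context: $\overline{K_m}$ is the edgeless graph on $m$ vertices; $T_{2,n}$ is the $1$-subdivision of the star $K_{1,n}$; $nT_{2,n}$ is the disjoint union of $n$ copies of it. For two $m$-vertex graphs $G,H$ on disjoint vertex sets with orderings $v_1,\dots,v_m$ and $w_1,\dots,w_m$, $G\oplus_{=}H$ (resp. $G\oplus_{\neq}H$) is the graph on $V(G)\cup V(H)$ inducing $G$ on $V(G)$ and $H$ on $V(H)$, in which $v_iw_j$ is an edge iff $i=j$ (resp. iff $i\neq j$). For $\odot\in\{\oplus_=,\oplus_{\neq}\}$, a positive integer $s$ and a $0$-$1$ matrix $A=\begin{pmatrix}a&b\\c&d\end{pmatrix}$, $(G\odot H)^s_A$ is the disjoint union of $s$ copies of $G\odot H$ with added edges such that for all $1\le i<j\le s$, the $i$-th copy of $G$ is complete (if $a=1$) or anti-complete (if $a=0$) to the $j$-th copy of $G$; likewise with $b$ for ($i$-th $G$, $j$-th $H$), $c$ for ($i$-th $H$, $j$-th $G$), and $d$ for ($i$-th $H$, $j$-th $H$). A vertex-minor of $G$ is an induced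 subgraph of a graph obtained from $G$ by a sequence of local complementations, where local complementation at $v$ replaces the subgraph induced on $N_G(v)$ by its complement. -}

module Defs where

open import Data.Nat using (ℕ; _<_; _≤_)
open import Data.Nat.Properties using (<-cmp)
open import Data.Bool using (Bool; true; false; not; _∧_; if_then_else_)
open import Data.Bool.Properties using () renaming (_≟_ to _≟B_)
open import Data.Fin using (Fin; toℕ)
open import Data.Fin.Properties using () renaming (_≟_ to _≟F_)
open import Data.Maybe using (Maybe; just; nothing)
open import Data.Product using (_×_; _,_; Σ; ∃)
open import Data.List using (List; []; _∷_)
open import Relation.Nullary using (yes; no)
open import Relation.Nullary.Decidable using (⌊_⌋)
open import Relation.Binary using (DecidableEquality; Tri; tri<; tri≈; tri>)
open import Relation.Binary.PropositionalEquality using (_≡_)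
open import Function.Definitions using (Injective)

-- All graphs built below are symmetric and
-- loopless by construction, and local complementation preserves this.
Graph : Set → Set
Graph V = V → V → Bool

localComp : {V : Set} → DecidableEquality V → Graph V → V → Graph V
localComp _≟_ G v x y =
  if G v x ∧ G v y ∧ not ⌊ x ≟ y ⌋ then not (G x y) else G x y

localComps : {V : Set} → DecidableEquality V → Graph V → List V → Graph V
localComps _≟_ G [] = G
localComps _≟_ G (v ∷ vs) = localComps _≟_ (localComp _≟_ G v) vs

IsoInduced : {W V : Set} → Graph W → Graph V → Set
IsoInduced {W} {V} H G =
  Σ (W → V) λ f → Injective _≡_ _≡_ f × (∀ x y → H x y ≡ G (f x) (f y))

HasVertexMinor : {V W : Set} → DecidableEquality V → Graph V → Graph W → Set
HasVertexMinor {V} _≟_ G H =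
  Σ (List V) λ vs → IsoInduced H (localComps _≟_ G vs)

K : (m : ℕ) → Graph (Fin m)
K m i j = not ⌊ i ≟F j ⌋

Kbar : (m : ℕ) → Graph (Fin m)
Kbar m i j = false

data Join : Set where
  join= join≠ : Join

joinAdj : {m : ℕ} → Join → Fin m → Fin m → Bool
joinAdj join= i j = ⌊ i ≟F j ⌋
joinAdj join≠ i j = not ⌊ i ≟F j ⌋

-- A 2x2 0-1 matrix, indexed by sides (false = G-side, true = H-side).
Matrix2 : Set
Matrix2 = Bool → Bool → Bool

mat : Bool → Bool → Bool → Bool → Matrix2
mat a b c d false false = a
mat a b c d false true  = b
mat a b c d true  false = c
mat a b c d true  true  = d

-- Vertices of (G ⊙ H)^s_A: (copy index, side, index in 1..m).
BVert : ℕ → ℕ → Set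
BVert s m = Fin s × Bool × Fin m

BVert-≟ : (s m : ℕ) → DecidableEquality (BVert s m)
BVert-≟ s m (k , p , i) (l , q , j) with k ≟F l | p ≟B q | i ≟F j
... | yes Relation.Binary.PropositionalEquality.refl | yes Relation.Binary.PropositionalEquality.refl | yes Relation.Binary.PropositionalEquality.refl = yes Relation.Binary.PropositionalEquality.refl
... | no ne | _ | _ = no λ { Relation.Binary.PropositionalEquality.refl → ne Relation.Binary.PropositionalEquality.refl }
... | yes _ | no ne | _ = no λ { Relation.Binary.PropositionalEquality.refl → ne Relation.Binary.PropositionalEquality.refl }
... | yes _ | yes _ | no ne = no λ { Relation.Binary.PropositionalEquality.refl → ne Relation.Binary.PropositionalEquality.refl }

blowup : {m : ℕ} → (s : ℕ) → Graph (Fin m) → Join → Graph (Fin m) → Matrix2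
       → Graph (BVert s m)
blowup s G ⊙ H A (k , p , i) (l , q , j) with <-cmp (toℕ k) (toℕ l)
... | tri< _ _ _ = A p q
... | tri> _ _ _ = A q p
... | tri≈ _ _ _ = side p q
  where
  side : Bool → Bool → Bool
  side false false = G i j
  side true  true  = H i j
  side false true  = joinAdj ⊙ i j
  side true  false = joinAdj ⊙ j i

-- T_{2,n}: 1-subdivision of the star K_{1,n}.  Vertices: nothing = centre,
-- just (j , false) = subdivision vertex of leg j, just (j , true) = leaf j.
T2 : (n : ℕ) → Graph (Maybe (Fin n × Bool))
T2 n nothing nothing = false
T2 n nothing (just (_ , b)) = not b
T2 n (just (_ , b)) nothing = not b
T2 n (just (i , b)) (just (j , c)) = ⌊ i ≟F j ⌋ ∧ not ⌊ b ≟B c ⌋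

nT2 : (n : ℕ) → Graph (Fin n × Maybe (Fin n × Bool))
nT2 n (a , x) (b , y) = ⌊ a ≟F b ⌋ ∧ T2 n x y

module Submission where

-- Put N = n + 2 and call copies and indices 2,…,n+1 main,
-- 0 and 1 auxiliary.  The a-th component of n T_{2,n} is placed in main
-- copy a+2: centre at (a+2, G, 0), middle vertex of leg j at (a+2, G, j+2),
-- leaf of leg j at (a+2, H, j+2).  All graphs met along the way are uniform:
-- adjacency of x, y depends only on their pair type (classes 0/1/main of
-- copies and indices, sides, coincidence of copies and of indices), i.e.
-- is given by a pattern.  Local complementation at the independent vertices
-- of a template (copy and index pinned to 0/1 or ranging over the main
-- values) maps a pattern to a computable pattern: the flips add up, and a
-- sum over the main values depends only on the parity of n (paritySum).
-- So running a schedule of templates, its independence conditions and the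
-- comparison with n T_{2,n} are a finite Boolean computation, checked for
-- every ⊙, H, d and parity of n (certificate); two schedules cover all cases.

open import Defs
open import Data.Nat using (ℕ; zero; suc; _+_; _≤_)
open import Data.Nat.Properties using (+-comm; <-cmp; <-irrefl)
open import Data.Bool using (Bool; true; false; not; _∧_; _xor_; if_then_else_; T)
open import Data.Bool.Properties
  using (xor-assoc; xor-identityʳ; ∧-zeroʳ; T-∧; T-not-≡) renaming (_≟_ to _≟B_)
open import Data.Bool.Solver using (module xor-∧-Solver)
open import Data.Fin using (Fin; zero; suc; toℕ)
open import Data.Fin.Properties using (toℕ-injective) renaming (_≟_ to _≟F_)
open import Data.Maybe using (Maybe; just; nothing; is-just; fromMaybe)
import Data.Maybe as Maybe
open import Data.Product using (_×_; _,_; proj₁; proj₂)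
open import Data.List using (List; []; _∷_; _++_; map; concatMap; tabulate)
open import Data.List.Relation.Unary.All using (All; []; _∷_)
import Data.List.Relation.Unary.All as All
open import Data.List.Relation.Unary.All.Properties using (concat⁺; map⁺; tabulate⁺)
open import Data.Empty using (⊥-elim)
open import Data.Unit using (tt)
open import Function using (_∘_; Equivalence)
open import Relation.Nullary using (yes; no; does)
open import Relation.Nullary.Decidable using (⌊_⌋; toWitness; isYes≗does)
open import Relation.Binary using (DecidableEquality; tri<; tri≈; tri>)
open import Relation.Binary.PropositionalEquality
  using (_≡_; _≢_; refl; sym; trans; cong; cong₂; subst; module ≡-Reasoning)

open ≡-Reasoning

xor-interchange : ∀ a b c d → (a xor b) xor (c xor d) ≡ (a xor c) xor (b xor d)
xor-interchange = solve 4 (λ a b c d → (a :+ b) :+ (c :+ d) := (a :+ c) :+ (b :+ d)) refl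
  where open xor-∧-Solver

-- Local complementation is written with if_then_else_; it is an xor.
if-not-xor : ∀ b x → (if b then not x else x) ≡ x xor b
if-not-xor true  true  = refl
if-not-xor true  false = refl
if-not-xor false true  = refl
if-not-xor false false = refl

T-∧⁻ : ∀ a b → T (a ∧ b) → T a × T b
T-∧⁻ a b = Equivalence.to (T-∧ {a} {b})

T-both : (P : Bool → Bool) → T (P true ∧ P false) → ∀ b → T (P b)
T-both P t true  = proj₁ (T-∧⁻ (P true) (P false) t)
T-both P t false = proj₂ (T-∧⁻ (P true) (P false) t)

-- Equality of elements of Fin as a Boolean.  Unlike ⌊ i ≟F j ⌋ it computes
-- structurally: suc i == suc j reduces to i == j.
infix 7 _==_
_==_ : ∀ {m} → Fin m → Fin m → Bool
i == j = does (i ≟F j)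

==-sym : ∀ {m} (i j : Fin m) → (j == i) ≡ (i == j)
==-sym zero    zero    = refl
==-sym zero    (suc j) = refl
==-sym (suc i) zero    = refl
==-sym {suc m} (suc i) (suc j) = ==-sym {m} i j

xorFin : (n : ℕ) → (Fin n → Bool) → Bool
xorFin zero    f = false
xorFin (suc n) f = f zero xor xorFin n (f ∘ suc)

odd : ℕ → Bool
odd zero    = false
odd (suc n) = not (odd n)

xorFin-cong : ∀ n {f g : Fin n → Bool} → (∀ a → f a ≡ g a) → xorFin n f ≡ xorFin n g
xorFin-cong zero    eq = refl
xorFin-cong (suc n) eq = cong₂ _xor_ (eq zero) (xorFin-cong n (eq ∘ suc))

xorFin-xor : ∀ n (f g : Fin n → Bool) →
             xorFin n (λ a → f a xor g a) ≡ xorFin n f xor xorFin n g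
xorFin-xor zero    f g = refl
xorFin-xor (suc n) f g =
  trans (cong ((f zero xor g zero) xor_) (xorFin-xor n (f ∘ suc) (g ∘ suc)))
        (xor-interchange (f zero) (g zero) _ _)

xorFin-const : ∀ n c → xorFin n (λ _ → c) ≡ odd n ∧ c
xorFin-const zero    c = refl
xorFin-const (suc n) c = trans (cong (c xor_) (xorFin-const n c)) (step c (odd n))
  where
  step : ∀ c b → c xor (b ∧ c) ≡ not b ∧ c
  step true  true  = refl
  step true  false = refl
  step false true  = refl
  step false false = refl

xorFin-false : ∀ n → xorFin n (λ _ → false) ≡ false
xorFin-false n = trans (xorFin-const n false) (∧-zeroʳ (odd n))

xorFin-delta : ∀ {n} (b : Fin n) (g : Fin n → Bool) →
               xorFin n (λ a → (a == b) ∧ g a) ≡ g b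
xorFin-delta {suc n} zero    g = trans (cong (g zero xor_) (xorFin-false n)) (xor-identityʳ (g zero))
xorFin-delta {suc n} (suc b) g = xorFin-delta b (g ∘ suc)

hits : ∀ {n} → Fin n → Maybe (Fin n) → Bool
hits a nothing  = false
hits a (just b) = a == b

atHit : ∀ {n} → Maybe (Fin n) → (Fin n → Bool) → Bool
atHit nothing  g = false
atHit (just b) g = g b

xorFin-hits : ∀ n (m : Maybe (Fin n)) g → xorFin n (λ a → hits a m ∧ g a) ≡ atHit m g
xorFin-hits n nothing  g = xorFin-false n
xorFin-hits n (just b) g = xorFin-delta b g

atHit-const : ∀ {n} (m : Maybe (Fin n)) c → atHit m (λ _ → c) ≡ is-just m ∧ c
atHit-const nothing  c = refl
atHit-const (just b) c = refl

atHit-∧ : ∀ {n} (m : Maybe (Fin n)) g c → atHit m (λ a → g a ∧ c) ≡ atHit m g ∧ c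
atHit-∧ nothing  g c = refl
atHit-∧ (just b) g c = refl

-- Coefficients of a Boolean function of (s, t) in the basis 1, s, t, st.
coef₀ coefˢ coefᵗ coefˢᵗ : (Bool → Bool → Bool) → Bool
coef₀  F = F false false
coefˢ  F = F true false xor F false false
coefᵗ  F = F false true xor F false false
coefˢᵗ F = F true true xor F true false xor F false true xor F false false

expand : ∀ F s t → F s t ≡ coef₀ F xor ((s ∧ coefˢ F) xor ((t ∧ coefᵗ F) xor (s ∧ (t ∧ coefˢᵗ F))))
expand F false false = sym (xor-identityʳ (F false false))
expand F true  false = solve 2 (λ a b → b := a :+ ((b :+ a) :+ con false)) refl (F false false) (F true false)
  where open xor-∧-Solver
expand F false true  = solve 2 (λ a b → b := a :+ ((b :+ a) :+ con false)) refl (F false false) (F false true)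
  where open xor-∧-Solver
expand F true  true  =
  solve 4 (λ a b c d → d := a :+ ((b :+ a) :+ ((c :+ a) :+ (d :+ (b :+ (c :+ a)))))) refl
        (F false false) (F true false) (F false true) (F true true)
  where open xor-∧-Solver

-- linearSum F hx hy hxy pr is the sum over a ∈ Fin n of F [a = x] [a = y],
-- where hx, hy say whether the points x, y exist, hxy whether they exist and
-- agree, and pr is the parity of n.
linearSum : (Bool → Bool → Bool) → Bool → Bool → Bool → Bool → Bool
linearSum F hx hy hxy pr = (pr ∧ coef₀ F) xor ((hx ∧ coefˢ F) xor ((hy ∧ coefᵗ F) xor (hxy ∧ coefˢᵗ F)))

paritySum : ∀ n F (mx my : Maybe (Fin n)) →
  xorFin n (λ a → F (hits a mx) (hits a my))
    ≡ linearSum F (is-just mx) (is-just my) (atHit mx (λ a → hits a my)) (odd n)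
paritySum n F mx my = begin
  xorFin n (λ a → F (hx a) (hy a))
    ≡⟨ xorFin-cong n (λ a → expand F (hx a) (hy a)) ⟩
  xorFin n (λ a → coef₀ F xor ((hx a ∧ coefˢ F) xor ((hy a ∧ coefᵗ F) xor (hx a ∧ (hy a ∧ coefˢᵗ F)))))
    ≡⟨ xorFin-xor n _ _ ⟩
  xorFin n (λ _ → coef₀ F) xor xorFin n (λ a → (hx a ∧ coefˢ F) xor ((hy a ∧ coefᵗ F) xor (hx a ∧ (hy a ∧ coefˢᵗ F))))
    ≡⟨ cong (xorFin n (λ _ → coef₀ F) xor_) (xorFin-xor n _ _) ⟩
  xorFin n (λ _ → coef₀ F) xor (xorFin n (λ a → hx a ∧ coefˢ F) xor xorFin n (λ a → (hy a ∧ coefᵗ F) xor (hx a ∧ (hy a ∧ coefˢᵗ F))))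
    ≡⟨ cong (λ z → xorFin n (λ _ → coef₀ F) xor (xorFin n (λ a → hx a ∧ coefˢ F) xor z)) (xorFin-xor n _ _) ⟩
  xorFin n (λ _ → coef₀ F) xor (xorFin n (λ a → hx a ∧ coefˢ F) xor
    (xorFin n (λ a → hy a ∧ coefᵗ F) xor xorFin n (λ a → hx a ∧ (hy a ∧ coefˢᵗ F))))
    ≡⟨ cong₂ _xor_ (xorFin-const n (coef₀ F))
         (cong₂ _xor_ (trans (xorFin-hits n mx _) (atHit-const mx _))
           (cong₂ _xor_ (trans (xorFin-hits n my _) (atHit-const my _))
                        (trans (xorFin-hits n mx _) (atHit-∧ mx hy _)))) ⟩
  linearSum F (is-just mx) (is-just my) (atHit mx hy) (odd n) ∎
  where
  hx hy : Fin n → Bool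
  hx a = hits a mx
  hy a = hits a my

-- The same sum, evaluated so that F is only queried at the arguments that
-- matter; this keeps the certificate computation below fast.
Ψ : (Bool → Bool → Bool) → Bool → Bool → Bool → Bool → Bool
Ψ F hx hy s pr = (pr ∧ F false false) xor
  (if hx ∧ hy then (if s then F true true xor F false false else F true false xor F false true)
   else if hx then F true false xor F false false
   else if hy then F false true xor F false false
   else false)

Ψ-linear : ∀ F hx hy s pr → Ψ F hx hy s pr ≡ linearSum F hx hy (hx ∧ hy ∧ s) pr
Ψ-linear F true  true  true  pr = cong ((pr ∧ F false false) xor_)
  (solve 4 (λ a b c d → d :+ a := (b :+ a) :+ ((c :+ a) :+ (d :+ (b :+ (c :+ a))))) refl
     (F false false) (F true false) (F false true) (F true true))
  where open xor-∧-Solver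
Ψ-linear F true  true  false pr = cong ((pr ∧ F false false) xor_)
  (solve 3 (λ a b c → b :+ c := (b :+ a) :+ ((c :+ a) :+ con false)) refl
     (F false false) (F true false) (F false true))
  where open xor-∧-Solver
Ψ-linear F true  false s     pr = cong ((pr ∧ F false false) xor_) (sym (xor-identityʳ _))
Ψ-linear F false true  s     pr = cong ((pr ∧ F false false) xor_) (sym (xor-identityʳ _))
Ψ-linear F false false s     pr = refl

private variable A B : Set

xorSum : (A → Bool) → List A → Bool
xorSum f []       = false
xorSum f (a ∷ as) = f a xor xorSum f as

xorSum-cong : ∀ {f g : A → Bool} → (∀ a → f a ≡ g a) → ∀ as → xorSum f as ≡ xorSum g as
xorSum-cong eq []       = refl
xorSum-cong eq (a ∷ as) = cong₂ _xor_ (eq a) (xorSum-cong eq as)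

xorSum-++ : ∀ (f : A → Bool) as bs → xorSum f (as ++ bs) ≡ xorSum f as xor xorSum f bs
xorSum-++ f []       bs = refl
xorSum-++ f (a ∷ as) bs = trans (cong (f a xor_) (xorSum-++ f as bs)) (sym (xor-assoc (f a) _ _))

xorSum-map : ∀ (f : B → Bool) (g : A → B) as → xorSum f (map g as) ≡ xorSum (f ∘ g) as
xorSum-map f g []       = refl
xorSum-map f g (a ∷ as) = cong (f (g a) xor_) (xorSum-map f g as)

xorSum-concatMap : ∀ (f : B → Bool) (g : A → List B) as →
                   xorSum f (concatMap g as) ≡ xorSum (λ a → xorSum f (g a)) as
xorSum-concatMap f g []       = refl
xorSum-concatMap f g (a ∷ as) =
  trans (xorSum-++ f (g a) (concatMap g as)) (cong (xorSum f (g a) xor_) (xorSum-concatMap f g as))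

xorSum-tabulate : ∀ n (f : A → Bool) (g : Fin n → A) → xorSum f (tabulate g) ≡ xorFin n (f ∘ g)
xorSum-tabulate zero    f g = refl
xorSum-tabulate (suc n) f g = cong (f (g zero) xor_) (xorSum-tabulate n f (g ∘ suc))

module LocalComplementation {V : Set} (_≟_ : DecidableEquality V) where

  flip : Graph V → V → V → V → Bool
  flip G v x y = G v x ∧ G v y ∧ not ⌊ x ≟ y ⌋

  localComp-xor : ∀ G v x y → localComp _≟_ G v x y ≡ G x y xor flip G v x y
  localComp-xor G v x y = if-not-xor (flip G v x y) (G x y)

  localComp-outside : ∀ G v u z → G v u ≡ false → localComp _≟_ G v u z ≡ G u z
  localComp-outside G v u z nonadj =
    cong (λ b → if b ∧ G v z ∧ not ⌊ u ≟ z ⌋ then not (G u z) else G u z) nonadj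

  localComps-++ : ∀ G us vs → localComps _≟_ G (us ++ vs) ≡ localComps _≟_ (localComps _≟_ G us) vs
  localComps-++ G []       vs = refl
  localComps-++ G (u ∷ us) vs = localComps-++ (localComp _≟_ G u) us vs

  Independent : Graph V → (V → Set) → Set
  Independent G P = ∀ u w → P u → P w → G u w ≡ false

  localComps-independent : ∀ (P : V → Set) G vs → All P vs → Independent G P →
    ∀ x y → localComps _≟_ G vs x y ≡ G x y xor xorSum (λ v → flip G v x y) vs
  localComps-independent P G []       []         indep x y = sym (xor-identityʳ (G x y))
  localComps-independent P G (v ∷ vs) (pv ∷ pvs) indep x y = begin
    localComps _≟_ G′ vs x y
      ≡⟨ localComps-independent P G′ vs pvs indep′ x y ⟩
    G′ x y xor xorSum (λ u → flip G′ u x y) vs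
      ≡⟨ cong₂ _xor_ (localComp-xor G v x y) (flips-unchanged vs pvs) ⟩
    (G x y xor flip G v x y) xor xorSum (λ u → flip G u x y) vs
      ≡⟨ xor-assoc (G x y) _ _ ⟩
    G x y xor xorSum (λ u → flip G u x y) (v ∷ vs) ∎
    where
    G′ : Graph V
    G′ = localComp _≟_ G v
    row-unchanged : ∀ u z → P u → G′ u z ≡ G u z
    row-unchanged u z pu = localComp-outside G v u z (indep v u pv pu)
    indep′ : Independent G′ P
    indep′ u w pu pw = trans (row-unchanged u w pu) (indep u w pu pw)
    flips-unchanged : ∀ us → All P us → xorSum (λ u → flip G′ u x y) us ≡ xorSum (λ u → flip G u x y) us
    flips-unchanged []       []         = refl
    flips-unchanged (u ∷ us) (pu ∷ pus) =
      cong₂ _xor_ (cong₂ _∧_ (row-unchanged u x pu) (cong (_∧ _) (row-unchanged u y pu)))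
                  (flips-unchanged us pus)

blowup-apart : ∀ {s m} (G H : Graph (Fin m)) ⊙ (A : Matrix2) → (∀ p q → A q p ≡ A p q) →
  ∀ {k l : Fin s} p q i j → k ≢ l → blowup s G ⊙ H A (k , p , i) (l , q , j) ≡ A p q
blowup-apart G H ⊙ A A-sym {k} {l} p q i j k≢l with <-cmp (toℕ k) (toℕ l)
... | tri< _ _ _  = refl
... | tri≈ _ eq _ = ⊥-elim (k≢l (toℕ-injective eq))
... | tri> _ _ _  = A-sym p q

mat-sym : ∀ d p q → mat false true true d q p ≡ mat false true true d p q
mat-sym d false false = refl
mat-sym d false true  = refl
mat-sym d true  false = refl
mat-sym d true  true  = refl

-- Class of a copy or an index: 0, 1, or one of the n main values.
data Class : Set where
  aux₀ aux₁ main : Class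

isMain : Class → Bool
isMain main = true
isMain _    = false

-- Type of a vertex: copy class, side (false = G, true = H), index class.
VType : Set
VType = Class × Bool × Class

record PairType : Set where
  constructor pair
  field
    first second        : VType
    sameCopy sameIndex  : Bool

Pattern : Set
Pattern = PairType → Bool

distinct : PairType → Bool
distinct (pair (_ , p , _) (_ , q , _) s e) = not (s ∧ does (p ≟B q) ∧ e)

-- A coordinate (copy or index) of the vertices of a template is either
-- pinned to 0 (pin false) or 1 (pin true), or ranges over all main values.
data Coord : Set where
  pin   : Bool → Coord
  every : Coord

pinClass : Bool → Class
pinClass false = aux₀
pinClass true  = aux₁

coordClass : Coord → Class
coordClass (pin b) = pinClass b
coordClass every   = main

pinHit : Bool → Class → Bool
pinHit false aux₀ = true
pinHit true  aux₁ = true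
pinHit _     _    = false

-- coordSum c pr F cx cy s is the sum of F (class w) [w = x] [w = y] over
-- the values w of coordinate c, for x, y of classes cx, cy with [x = y] = s,
-- when n has parity pr.
coordSum : Coord → Bool → (Class → Bool → Bool → Bool) → Class → Class → Bool → Bool
coordSum (pin b) pr F cx cy s = F (pinClass b) (pinHit b cx) (pinHit b cy)
coordSum every   pr F cx cy s = Ψ (F main) (isMain cx) (isMain cy) s pr

-- P holds for every possible value of [w = w′] with w, w′ values of c, c′.
allCoincide : Coord → Coord → (Bool → Bool) → Bool
allCoincide (pin b) (pin b′) P = P (does (b ≟B b′))
allCoincide (pin _) every    P = P false
allCoincide every   (pin _)  P = P false
allCoincide every   every    P = P true ∧ P false

record Template : Set where
  constructor template
  field
    copy  : Coord
    side  : Bool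
    index : Coord

lcPattern : Bool → Template → Pattern → Pattern
lcPattern pr (template c s i) Φ A@(pair tx@(cx , _ , ix) ty@(cy , _ , iy) sc si) =
  Φ A xor coordSum c pr (λ cw sx sy → coordSum i pr (λ iw ex ey →
            Φ (pair (cw , s , iw) tx sx ex) ∧ Φ (pair (cw , s , iw) ty sy ey) ∧ distinct A)
          ix iy si) cx cy sc

independent : Template → Pattern → Bool
independent (template c s i) Φ =
  allCoincide c c λ sc → allCoincide i i λ si →
    not (Φ (pair (coordClass c , s , coordClass i) (coordClass c , s , coordClass i) sc si))

run : Bool → List Template → Pattern → Pattern
run pr []       Φ = Φ
run pr (t ∷ ts) Φ = run pr ts (lcPattern pr t Φ)

valid : Bool → List Template → Pattern → Bool
valid pr []       Φ = true
valid pr (t ∷ ts) Φ = independent t Φ ∧ valid pr ts (lcPattern pr t Φ)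

data Shape : Set where
  clique stable : Shape

shapeGraph : Shape → (m : ℕ) → Graph (Fin m)
shapeGraph clique = K
shapeGraph stable = Kbar

shapeBit : Shape → Bool → Bool
shapeBit clique e = not e
shapeBit stable e = false

joinBit : Join → Bool → Bool
joinBit join= e = e
joinBit join≠ e = not e

withinCopy : Join → Shape → Bool → Bool → Bool → Bool
withinCopy ⊙ σ false false e = not e
withinCopy ⊙ σ true  true  e = shapeBit σ e
withinCopy ⊙ σ false true  e = joinBit ⊙ e
withinCopy ⊙ σ true  false e = joinBit ⊙ e

initialPattern : Join → Shape → Bool → Pattern
initialPattern ⊙ σ d (pair (_ , p , _) (_ , q , _) s e) =
  if s then withinCopy ⊙ σ p q e else mat false true true d p q

-- A vertex of T_{2,n} up to its leg: centre (nothing), middle vertex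
-- (just false) or leaf (just true) of a leg.
allShapes : (Maybe Bool → Bool) → Bool
allShapes P = P nothing ∧ P (just false) ∧ P (just true)

allShapes-sound : ∀ P → T (allShapes P) → ∀ x → T (P x)
allShapes-sound P t nothing      = proj₁ (T-∧⁻ (P nothing) _ t)
allShapes-sound P t (just false) = proj₁ (T-∧⁻ (P (just false)) _ (proj₂ (T-∧⁻ (P nothing) _ t)))
allShapes-sound P t (just true)  = proj₂ (T-∧⁻ (P (just false)) _ (proj₂ (T-∧⁻ (P nothing) _ t)))

-- Centres sit at index 0, leg vertices at the main index of their leg.
legCoord : Maybe Bool → Coord
legCoord nothing  = pin false
legCoord (just _) = every

T2pattern : Maybe Bool → Maybe Bool → Bool → Bool
T2pattern nothing  nothing  e = false
T2pattern nothing  (just c) e = not c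
T2pattern (just b) nothing  e = not b
T2pattern (just b) (just c) e = e ∧ not (does (b ≟B c))

-- The embedded pair of shapes x, y (with index classes cx, cy), in the same
-- copy iff s and on the same leg iff e, is adjacent as in n T_{2,n}.
agreesNT2 : Pattern → Bool → Maybe Bool → Maybe Bool → Class → Class → Bool → Bool
agreesNT2 Φ s x y cx cy e =
  ⌊ Φ (pair (main , fromMaybe false x , cx) (main , fromMaybe false y , cy) s e) ≟B (s ∧ T2pattern x y e) ⌋

legsAgree : Pattern → Bool → Maybe Bool → Maybe Bool → Bool
legsAgree Φ s x y =
  allCoincide (legCoord x) (legCoord y) (agreesNT2 Φ s x y (coordClass (legCoord x)) (coordClass (legCoord y)))

embedsNT2 : Pattern → Bool
embedsNT2 Φ = allCoincide every every λ s → allShapes λ x → allShapes (legsAgree Φ s x)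

-- Local complementation at a vertex of the auxiliary copy 0; such a vertex
-- is adjacent in the same way to all main copies.
atAux : Bool → Bool → Template
atAux side idx = template (pin false) side (pin idx)

-- The H-side auxiliary index adjacent to (0, G, 0) in the same copy.
crossIndex : Join → Bool
crossIndex join= = false
crossIndex join≠ = true

-- Auxiliary steps, in an order depending on a bit δ (d for viaCentres,
-- d xor the parity of n for viaLegs).
cleanup : Join → Bool → List Template
cleanup ⊙ true  = atAux true (crossIndex ⊙) ∷ atAux false false ∷ []
cleanup ⊙ false = atAux false false ∷ atAux true (crossIndex ⊙) ∷ atAux false false ∷ []

-- The n future centres (a+2, G, 0).
centres : Template
centres = template every false (pin false)

viaCentres : Join → Bool → List Template
viaCentres ⊙ d = cleanup ⊙ d ++ centres ∷ template every true (pin true) ∷ []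

viaLegs : Join → Bool → Bool → List Template
viaLegs ⊙ d pr = centres ∷ template every false every ∷ cleanup ⊙ (d xor pr)

-- viaLegs is needed exactly when ⊙ is ⊕_= and the H-part of a copy is
-- complete iff the H-parts of different copies are not joined.
schedule : Join → Shape → Bool → Bool → List Template
schedule join= clique false pr = viaLegs join= false pr
schedule join= stable true  pr = viaLegs join= true pr
schedule ⊙     σ      d     pr = viaCentres ⊙ d

certified : Bool → List Template → Pattern → Bool
certified pr ts Φ = valid pr ts Φ ∧ embedsNT2 (run pr ts Φ)

certificate : ∀ ⊙ σ d pr → T (certified pr (schedule ⊙ σ d pr) (initialPattern ⊙ σ d))
certificate join= clique true  true  = tt
certificate join= clique true  false = tt
certificate join= clique false true  = tt
certificate join= clique false false = tt
certificate join= stable true  true  = tt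
certificate join= stable true  false = tt
certificate join= stable false true  = tt
certificate join= stable false false = tt
certificate join≠ clique true  true  = tt
certificate join≠ clique true  false = tt
certificate join≠ clique false true  = tt
certificate join≠ clique false false = tt
certificate join≠ stable true  true  = tt
certificate join≠ stable true  false = tt
certificate join≠ stable false true  = tt
certificate join≠ stable false false = tt

module Realisation (n : ℕ) where

  N : ℕ
  N = suc (suc n)

  V : Set
  V = BVert N N

  _≟V_ : DecidableEquality V
  _≟V_ = BVert-≟ N N

  open LocalComplementation _≟V_

  classOf : Fin N → Class
  classOf zero          = aux₀
  classOf (suc zero)    = aux₁
  classOf (suc (suc _)) = main

  typeOf : V → VType
  typeOf (k , p , i) = classOf k , p , classOf i

  pairTypeOf : V → V → PairType
  pairTypeOf x@(k , _ , i) y@(l , _ , j) = pair (typeOf x) (typeOf y) (k == l) (i == j)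

  Follows : Graph V → Pattern → Set
  Follows G Φ = ∀ x y → G x y ≡ Φ (pairTypeOf x y)

  ≟V-bits : ∀ k p i l q j →
            ⌊ (k , p , i) ≟V (l , q , j) ⌋ ≡ (k == l) ∧ does (p ≟B q) ∧ (i == j)
  ≟V-bits k p i l q j with k ≟F l | p ≟B q | i ≟F j
  ... | yes refl | yes refl | yes refl = refl
  ... | no _     | _        | _        = refl
  ... | yes refl | no _     | _        = refl
  ... | yes refl | yes refl | no _     = refl

  distinct-sound : ∀ x y → not ⌊ x ≟V y ⌋ ≡ distinct (pairTypeOf x y)
  distinct-sound (k , p , i) (l , q , j) = cong not (≟V-bits k p i l q j)

  pinValue : Bool → Fin N
  pinValue false = zero
  pinValue true  = suc zero

  choices : Coord → List (Fin N)
  choices (pin b) = pinValue b ∷ []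
  choices every   = tabulate (λ a → suc (suc a))

  data _∈ᶜ_ : Fin N → Coord → Set where
    in-pin₀  : zero ∈ᶜ pin false
    in-pin₁  : suc zero ∈ᶜ pin true
    in-every : (a : Fin n) → suc (suc a) ∈ᶜ every

  choices-∈ : ∀ c → All (_∈ᶜ c) (choices c)
  choices-∈ (pin false) = in-pin₀ ∷ []
  choices-∈ (pin true)  = in-pin₁ ∷ []
  choices-∈ every       = tabulate⁺ in-every

  -- The coincidences checked by allCoincide are all that can occur.
  coincide-sound : ∀ {c c′ k k′} (P : Class → Class → Bool → Bool) → k ∈ᶜ c → k′ ∈ᶜ c′ →
    T (allCoincide c c′ (P (coordClass c) (coordClass c′))) → T (P (classOf k) (classOf k′) (k == k′))
  coincide-sound P in-pin₀      in-pin₀       t = t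
  coincide-sound P in-pin₀      in-pin₁       t = t
  coincide-sound P in-pin₁      in-pin₀       t = t
  coincide-sound P in-pin₁      in-pin₁       t = t
  coincide-sound P in-pin₀      (in-every _)  t = t
  coincide-sound P in-pin₁      (in-every _)  t = t
  coincide-sound P (in-every _) in-pin₀       t = t
  coincide-sound P (in-every _) in-pin₁       t = t
  coincide-sound P (in-every a) (in-every a′) t = T-both (P main main) t (a == a′)

  pin-hit : ∀ b k → (pinValue b == k) ≡ pinHit b (classOf k)
  pin-hit false zero          = refl
  pin-hit false (suc zero)    = refl
  pin-hit false (suc (suc _)) = refl
  pin-hit true  zero          = refl
  pin-hit true  (suc zero)    = refl
  pin-hit true  (suc (suc _)) = refl

  mainPart : Fin N → Maybe (Fin n)
  mainPart (suc (suc a)) = just a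
  mainPart _             = nothing

  main-hit : ∀ a k → (suc (suc a) == k) ≡ hits a (mainPart k)
  main-hit a zero          = refl
  main-hit a (suc zero)    = refl
  main-hit a (suc (suc b)) = refl

  mainPart-isMain : ∀ k → is-just (mainPart k) ≡ isMain (classOf k)
  mainPart-isMain zero          = refl
  mainPart-isMain (suc zero)    = refl
  mainPart-isMain (suc (suc _)) = refl

  mainPart-same : ∀ k l → atHit (mainPart k) (λ a → hits a (mainPart l))
                          ≡ isMain (classOf k) ∧ isMain (classOf l) ∧ (k == l)
  mainPart-same zero          l             = refl
  mainPart-same (suc zero)    l             = refl
  mainPart-same (suc (suc a)) zero          = refl
  mainPart-same (suc (suc a)) (suc zero)    = refl
  mainPart-same (suc (suc a)) (suc (suc b)) = refl

  coordSum-sound : ∀ c (F : Class → Bool → Bool → Bool) (k l : Fin N) →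
    xorSum (λ w → F (classOf w) (w == k) (w == l)) (choices c)
      ≡ coordSum c (odd n) F (classOf k) (classOf l) (k == l)
  coordSum-sound (pin false) F k l =
    trans (xor-identityʳ _) (cong₂ (F aux₀) (pin-hit false k) (pin-hit false l))
  coordSum-sound (pin true) F k l =
    trans (xor-identityʳ _) (cong₂ (F aux₁) (pin-hit true k) (pin-hit true l))
  coordSum-sound every F k l = begin
    xorSum (λ w → F (classOf w) (w == k) (w == l)) (tabulate (λ a → suc (suc a)))
      ≡⟨ xorSum-tabulate n _ _ ⟩
    xorFin n (λ a → F main (suc (suc a) == k) (suc (suc a) == l))
      ≡⟨ xorFin-cong n (λ a → cong₂ (F main) (main-hit a k) (main-hit a l)) ⟩
    xorFin n (λ a → F main (hits a (mainPart k)) (hits a (mainPart l)))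
      ≡⟨ paritySum n (F main) (mainPart k) (mainPart l) ⟩
    linearSum (F main) (is-just (mainPart k)) (is-just (mainPart l)) (atHit (mainPart k) (λ a → hits a (mainPart l))) (odd n)
      ≡⟨ cong₂ (λ hx hy → linearSum (F main) hx hy same (odd n)) (mainPart-isMain k) (mainPart-isMain l) ⟩
    linearSum (F main) (isMain (classOf k)) (isMain (classOf l)) same (odd n)
      ≡⟨ cong (λ hxy → linearSum (F main) (isMain (classOf k)) (isMain (classOf l)) hxy (odd n)) (mainPart-same k l) ⟩
    linearSum (F main) (isMain (classOf k)) (isMain (classOf l)) (isMain (classOf k) ∧ isMain (classOf l) ∧ k == l) (odd n)
      ≡⟨ sym (Ψ-linear (F main) (isMain (classOf k)) (isMain (classOf l)) (k == l) (odd n)) ⟩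
    coordSum every (odd n) F (classOf k) (classOf l) (k == l) ∎
    where
    same : Bool
    same = atHit (mainPart k) (λ a → hits a (mainPart l))

  members : Template → List V
  members (template c s i) = concatMap (λ k → map (λ j → k , s , j) (choices i)) (choices c)

  _∈ₜ_ : V → Template → Set
  (k , p , j) ∈ₜ template c s i = k ∈ᶜ c × p ≡ s × j ∈ᶜ i

  members-∈ : ∀ t → All (_∈ₜ t) (members t)
  members-∈ (template c s i) =
    concat⁺ (map⁺ (All.map (λ k∈ → map⁺ (All.map (λ j∈ → k∈ , refl , j∈) (choices-∈ i))) (choices-∈ c)))

  independent-sound : ∀ t G Φ → Follows G Φ → T (independent t Φ) → Independent G (_∈ₜ t)
  independent-sound (template c s i) G Φ follows ok (k , _ , j) (k′ , _ , j′)
                    (k∈ , refl , j∈) (k′∈ , refl , j′∈) =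
    trans (follows _ _) (Equivalence.to T-not-≡ (coincide-sound onIndex j∈ j′∈ (coincide-sound onCopy k∈ k′∈ ok)))
    where
    onCopy : Class → Class → Bool → Bool
    onCopy ck ck′ sc = allCoincide i i λ si →
      not (Φ (pair (ck , s , coordClass i) (ck′ , s , coordClass i) sc si))
    onIndex : Class → Class → Bool → Bool
    onIndex ci ci′ si = not (Φ (pair (classOf k , s , ci) (classOf k′ , s , ci′) (k == k′) si))

  template-sound : ∀ t G Φ → Follows G Φ → T (independent t Φ) →
                   Follows (localComps _≟V_ G (members t)) (lcPattern (odd n) t Φ)
  template-sound t@(template c s i) G Φ follows ok x@(kx , _ , ix) y@(ky , _ , iy) = begin
    localComps _≟V_ G (members t) x y
      ≡⟨ localComps-independent (_∈ₜ t) G (members t) (members-∈ t) (independent-sound t G Φ follows ok) x y ⟩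
    G x y xor xorSum (λ v → flip G v x y) (members t)
      ≡⟨ cong₂ _xor_ (follows x y) flips ⟩
    lcPattern (odd n) t Φ (pairTypeOf x y) ∎
    where
    outer : Class → Bool → Bool → Bool
    outer cw sx sy = coordSum i (odd n) (λ iw ex ey →
        Φ (pair (cw , s , iw) (typeOf x) sx ex) ∧ Φ (pair (cw , s , iw) (typeOf y) sy ey)
      ∧ distinct (pairTypeOf x y)) (classOf ix) (classOf iy) (ix == iy)
    inner : Fin N → Class → Bool → Bool → Bool
    inner k iw ex ey =
        Φ (pair (classOf k , s , iw) (typeOf x) (k == kx) ex)
      ∧ Φ (pair (classOf k , s , iw) (typeOf y) (k == ky) ey) ∧ distinct (pairTypeOf x y)
    flip-follows : ∀ k j → flip G (k , s , j) x y ≡ inner k (classOf j) (j == ix) (j == iy)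
    flip-follows k j = cong₂ _∧_ (follows _ x) (cong₂ _∧_ (follows _ y) (distinct-sound x y))
    flips : xorSum (λ v → flip G v x y) (members t) ≡ coordSum c (odd n) outer (classOf kx) (classOf ky) (kx == ky)
    flips = begin
      xorSum (λ v → flip G v x y) (members t)
        ≡⟨ xorSum-concatMap _ _ (choices c) ⟩
      xorSum (λ k → xorSum (λ v → flip G v x y) (map (λ j → k , s , j) (choices i))) (choices c)
        ≡⟨ xorSum-cong (λ k → xorSum-map _ _ (choices i)) (choices c) ⟩
      xorSum (λ k → xorSum (λ j → flip G (k , s , j) x y) (choices i)) (choices c)
        ≡⟨ xorSum-cong (λ k → xorSum-cong (flip-follows k) (choices i)) (choices c) ⟩
      xorSum (λ k → xorSum (λ j → inner k (classOf j) (j == ix) (j == iy)) (choices i)) (choices c)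
        ≡⟨ xorSum-cong (λ k → coordSum-sound i (inner k) ix iy) (choices c) ⟩
      xorSum (λ k → outer (classOf k) (k == kx) (k == ky)) (choices c)
        ≡⟨ coordSum-sound c outer kx ky ⟩
      coordSum c (odd n) outer (classOf kx) (classOf ky) (kx == ky) ∎

  run-sound : ∀ ts G Φ → Follows G Φ → T (valid (odd n) ts Φ) →
              Follows (localComps _≟V_ G (concatMap members ts)) (run (odd n) ts Φ)
  run-sound []       G Φ follows ok = follows
  run-sound (t ∷ ts) G Φ follows ok =
    subst (λ H → Follows H (run (odd n) ts (lcPattern (odd n) t Φ)))
          (sym (localComps-++ G (members t) (concatMap members ts)))
          (run-sound ts _ _ (template-sound t G Φ follows (proj₁ ok′)) (proj₂ ok′))
    where ok′ = T-∧⁻ (independent t Φ) _ ok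

  blowupGraph : Join → Shape → Bool → Graph V
  blowupGraph ⊙ σ d = blowup N (K N) ⊙ (shapeGraph σ N) (mat false true true d)

  blowup-sameCopy : ∀ ⊙ σ d (k : Fin N) p q i j →
                    blowupGraph ⊙ σ d (k , p , i) (k , q , j) ≡ withinCopy ⊙ σ p q (i == j)
  blowup-sameCopy ⊙ σ d k p q i j with <-cmp (toℕ k) (toℕ k)
  blowup-sameCopy ⊙ σ      d k p     q     i j | tri< lt _ _ = ⊥-elim (<-irrefl refl lt)
  blowup-sameCopy ⊙ σ      d k p     q     i j | tri> _ _ gt = ⊥-elim (<-irrefl refl gt)
  blowup-sameCopy ⊙ σ      d k false false i j | tri≈ _ _ _  = cong not (isYes≗does (i ≟F j))
  blowup-sameCopy ⊙ clique d k true  true  i j | tri≈ _ _ _  = cong not (isYes≗does (i ≟F j))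
  blowup-sameCopy ⊙ stable d k true  true  i j | tri≈ _ _ _  = refl
  blowup-sameCopy join= σ  d k false true  i j | tri≈ _ _ _  = isYes≗does (i ≟F j)
  blowup-sameCopy join≠ σ  d k false true  i j | tri≈ _ _ _  = cong not (isYes≗does (i ≟F j))
  blowup-sameCopy join= σ  d k true  false i j | tri≈ _ _ _  = trans (isYes≗does (j ≟F i)) (==-sym i j)
  blowup-sameCopy join≠ σ  d k true  false i j | tri≈ _ _ _  = cong not (trans (isYes≗does (j ≟F i)) (==-sym i j))

  blowup-follows : ∀ ⊙ σ d → Follows (blowupGraph ⊙ σ d) (initialPattern ⊙ σ d)
  blowup-follows ⊙ σ d (k , p , i) (l , q , j) with k ≟F l
  ... | yes refl = blowup-sameCopy ⊙ σ d k p q i j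
  ... | no k≢l   = blowup-apart (K N) (shapeGraph σ N) ⊙ _ (mat-sym d) p q i j k≢l

  legShape : Maybe (Fin n × Bool) → Maybe Bool
  legShape = Maybe.map proj₂

  legIndex : Maybe (Fin n × Bool) → Fin N
  legIndex nothing        = zero
  legIndex (just (j , _)) = suc (suc j)

  legIndex-∈ : ∀ x → legIndex x ∈ᶜ legCoord (legShape x)
  legIndex-∈ nothing        = in-pin₀
  legIndex-∈ (just (j , _)) = in-every j

  embedding : Fin n × Maybe (Fin n × Bool) → V
  embedding (a , x) = suc (suc a) , fromMaybe false (legShape x) , legIndex x

  embedding-injective : ∀ u v → embedding u ≡ embedding v → u ≡ v
  embedding-injective (a , nothing)       (b , nothing)       refl = refl
  embedding-injective (a , just (i , b′)) (b , just (j , c))  refl = refl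

  T2-abstract : ∀ x y → T2 n x y ≡ T2pattern (legShape x) (legShape y) (legIndex x == legIndex y)
  T2-abstract nothing        nothing        = refl
  T2-abstract nothing        (just (j , c)) = refl
  T2-abstract (just (i , b)) nothing        = refl
  T2-abstract (just (i , b)) (just (j , c)) =
    cong₂ (λ e e′ → e ∧ not e′) (isYes≗does (i ≟F j)) (isYes≗does (b ≟B c))

  embedding-edges : ∀ G Φ → Follows G Φ → T (embedsNT2 Φ) →
                    ∀ u v → nT2 n u v ≡ G (embedding u) (embedding v)
  embedding-edges G Φ follows ok u@(a , x) v@(b , y) = begin
    ⌊ a ≟F b ⌋ ∧ T2 n x y
      ≡⟨ cong₂ _∧_ (isYes≗does (a ≟F b)) (T2-abstract x y) ⟩
    (a == b) ∧ T2pattern (legShape x) (legShape y) (legIndex x == legIndex y)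
      ≡⟨ sym (toWitness onIndex) ⟩
    Φ (pairTypeOf (embedding u) (embedding v))
      ≡⟨ sym (follows _ _) ⟩
    G (embedding u) (embedding v) ∎
    where
    sx sy : Maybe Bool
    sx = legShape x
    sy = legShape y
    onCopy : T (allShapes λ x′ → allShapes (legsAgree Φ (a == b) x′))
    onCopy = coincide-sound (λ _ _ s → allShapes λ x′ → allShapes (legsAgree Φ s x′)) (in-every a) (in-every b) ok
    onLegs : T (legsAgree Φ (a == b) sx sy)
    onLegs = allShapes-sound (legsAgree Φ (a == b) sx)
               (allShapes-sound (λ x′ → allShapes (legsAgree Φ (a == b) x′)) onCopy sx) sy
    onIndex : T (agreesNT2 Φ (a == b) sx sy (classOf (legIndex x)) (classOf (legIndex y)) (legIndex x == legIndex y))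
    onIndex = coincide-sound (agreesNT2 Φ (a == b) sx sy) (legIndex-∈ x) (legIndex-∈ y) onLegs

  vertexMinor : ∀ ⊙ σ d → HasVertexMinor _≟V_ (blowupGraph ⊙ σ d) (nT2 n)
  vertexMinor ⊙ σ d =
    concatMap members ts , embedding , (λ {u} {v} → embedding-injective u v) ,
    embedding-edges _ (run (odd n) ts Φ₀) (run-sound ts _ Φ₀ (blowup-follows ⊙ σ d) (proj₁ ok)) (proj₂ ok)
    where
    ts : List Template
    ts = schedule ⊙ σ d (odd n)
    Φ₀ : Pattern
    Φ₀ = initialPattern ⊙ σ d
    ok : T (valid (odd n) ts Φ₀) × T (embedsNT2 (run (odd n) ts Φ₀))
    ok = T-∧⁻ (valid (odd n) ts Φ₀) _ (certificate ⊙ σ d (odd n))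

-- The realisation works with N = suc (suc n); the statement uses n + 2.
atSize : ∀ n ⊙ σ d →
  HasVertexMinor (BVert-≟ (n + 2) (n + 2)) (blowup (n + 2) (K (n + 2)) ⊙ (shapeGraph σ (n + 2)) (mat false true true d)) (nT2 n)
atSize n ⊙ σ d =
  subst (λ N → HasVertexMinor (BVert-≟ N N) (blowup N (K N) ⊙ (shapeGraph σ N) (mat false true true d)) (nT2 n))
        (+-comm 2 n) (Realisation.vertexMinor n ⊙ σ d)

-- The four blow-ups.
lemma4p13 : (n : ℕ) → 2 ≤ n → (d : Bool) →
    HasVertexMinor (BVert-≟ (n + 2) (n + 2)) (blowup (n + 2) (K (n + 2)) join= (K (n + 2)) (mat false true true d)) (nT2 n)
    × HasVertexMinor (BVert-≟ (n + 2) (n + 2)) (blowup (n + 2) (K (n + 2)) join= (Kbar (n + 2)) (mat false true true d)) (nT2 n)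
    × HasVertexMinor (BVert-≟ (n + 2) (n + 2)) (blowup (n + 2) (K (n + 2)) join≠ (K (n + 2)) (mat false true true d)) (nT2 n)
    × HasVertexMinor (BVert-≟ (n + 2) (n + 2)) (blowup (n + 2) (K (n + 2)) join≠ (Kbar (n + 2)) (mat false true true d)) (nT2 n)
lemma4p13 n _ d =
  atSize n join= clique d , atSize n join= stable d , atSize n join≠ clique d , atSize n join≠ stable d
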